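{- A connected graph $G$ that contains a perfect matching is well-edge-dominated if and only if $G=K_4$ or $G=K_{n,n}$ for some integer $n\ge 1$.
   Context: All graphs are finite and simple. A set $F$ of edges is an edge dominating set if every edge not in $F$ shares an endpoint with some edge of $F$; it is minimal if no proper subset is an edge dominating set. A graph is well-edge-dominated if all its minimal edge dominating sets have the same cardinality. -}

module Defs where

open import Data.Nat using (ℕ; zero; suc; _+_; _*_; _≤_; _≡ᵇ_; _<ᵇ_)
open import Data.Fin using (Fin; toℕ)
open import Data.Bool using (Bool; true; false; not; _∧_; _xor_; if_then_else_)
open import Data.Bool.Properties using (xor-comm; xor-same)
open import Data.List using (List; map; allFin)
open import Data.Nat.ListAction using (sum)
open import Data.Product using (Σ; ∃; _×_; _,_)
open import Data.Sum using (_⊎_)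
open import Relation.Nullary using (¬_)
open import Relation.Binary.PropositionalEquality using (_≡_; refl; cong)
open import Function.Bundles using (_↔_; Inverse)

record Graph : Set where
  field
    vertices : ℕ
    adj      : Fin vertices → Fin vertices → Bool
    adj-sym  : ∀ i j → adj i j ≡ adj j i
    adj-irr  : ∀ i → adj i i ≡ false

open Graph public

record EdgeSet (G : Graph) : Set where
  field
    mem     : Fin (vertices G) → Fin (vertices G) → Bool
    mem-sym : ∀ i j → mem i j ≡ mem j i
    mem-sub : ∀ i j → mem i j ≡ true → adj G i j ≡ true

open EdgeSet public

card : {G : Graph} → EdgeSet G → ℕ
card {G} F =
  sum (map (λ i → sum (map (λ j → if mem F i j ∧ (toℕ i <ᵇ toℕ j) then 1 else 0)
                            (allFin (vertices G))))
           (allFin (vertices G)))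

_⊆E_ : {G : Graph} → EdgeSet G → EdgeSet G → Set
_⊆E_ {G} F F' = ∀ i j → mem F i j ≡ true → mem F' i j ≡ true

_⊂E_ : {G : Graph} → EdgeSet G → EdgeSet G → Set
_⊂E_ {G} F F' = (F ⊆E F') × ∃ λ i → ∃ λ j → (mem F' i j ≡ true) × (mem F i j ≡ false)

IsEdgeDominating : {G : Graph} → EdgeSet G → Set
IsEdgeDominating {G} F =
  ∀ i j → adj G i j ≡ true → mem F i j ≡ false →
    ∃ λ k → (mem F i k ≡ true) ⊎ (mem F j k ≡ true)

IsMinimalEdgeDominating : {G : Graph} → EdgeSet G → Set
IsMinimalEdgeDominating {G} F =
  IsEdgeDominating F × (∀ (F' : EdgeSet G) → F' ⊂E F → ¬ IsEdgeDominating F')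

WellEdgeDominated : Graph → Set
WellEdgeDominated G =
  ∀ (F F' : EdgeSet G) → IsMinimalEdgeDominating F → IsMinimalEdgeDominating F' →
    card F ≡ card F'

IsPerfectMatching : {G : Graph} → EdgeSet G → Set
IsPerfectMatching {G} M =
  ∀ v → ∃ λ u → (mem M v u ≡ true) × (∀ w → mem M v w ≡ true → w ≡ u)

HasPerfectMatching : Graph → Set
HasPerfectMatching G = ∃ λ (M : EdgeSet G) → IsPerfectMatching M

data Reach (G : Graph) : Fin (vertices G) → Fin (vertices G) → Set where
  here : ∀ {u} → Reach G u u
  step : ∀ {u w v} → adj G u w ≡ true → Reach G w v → Reach G u v

Connected : Graph → Set
Connected G = (1 ≤ vertices G) × (∀ u v → Reach G u v)

_≅_ : Graph → Graph → Set
G ≅ H = Σ (Fin (vertices G) ↔ Fin (vertices H)) λ f →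
          ∀ i j → adj G i j ≡ adj H (Inverse.to f i) (Inverse.to f j)

private
  ≡ᵇ-sym : ∀ m n → (m ≡ᵇ n) ≡ (n ≡ᵇ m)
  ≡ᵇ-sym zero zero = refl
  ≡ᵇ-sym zero (suc n) = refl
  ≡ᵇ-sym (suc m) zero = refl
  ≡ᵇ-sym (suc m) (suc n) = ≡ᵇ-sym m n

  ≡ᵇ-refl : ∀ m → (m ≡ᵇ m) ≡ true
  ≡ᵇ-refl zero = refl
  ≡ᵇ-refl (suc m) = ≡ᵇ-refl m

K4 : Graph
K4 = record
  { vertices = 4
  ; adj = λ i j → not (toℕ i ≡ᵇ toℕ j)
  ; adj-sym = λ i j → cong not (≡ᵇ-sym (toℕ i) (toℕ j))
  ; adj-irr = λ i → cong not (≡ᵇ-refl (toℕ i))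
  }

-- Complete bipartite graph K_{n,n}: vertices 0..n-1 and n..2n-1,
-- adjacent iff on different sides.
Knn : ℕ → Graph
Knn n = record
  { vertices = n + n
  ; adj = λ i j → (toℕ i <ᵇ n) xor (toℕ j <ᵇ n)
  ; adj-sym = λ i j → xor-comm (toℕ i <ᵇ n) (toℕ j <ᵇ n)
  ; adj-irr = λ i → xor-same (toℕ i <ᵇ n)
  }

-- Every maximal matching is a minimal edge dominating set, so in a well-edge-dominated graph with a
-- perfect matching no maximal matching misses two vertices. Hence every perfect matching p maps
-- non-adjacent pairs to non-adjacent pairs (otherwise unmatch them and match their partners); applied
-- to p switched along a 4-cycle this yields a transfer rule: on a path a – x – w with x matched to
-- neither a nor w, and w ≠ p a, p a is adjacent to w.
-- If some vertex sees both ends of a matching edge, the transfer rule spreads this along walks and G is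
-- complete; comparing a star with p then forces N = 4. Otherwise every vertex sees exactly one end of a
-- fixed matching edge, which splits G into two sides swapped by p with all edges across: G ≅ K n,n.
-- Conversely, a minimal edge dominating set of a complete bipartite graph covers a whole side with one
-- edge per vertex, so K n,n is well-edge-dominated; K4 is checked exhaustively.

module Submission where

open import Defs
open import Data.Nat using (ℕ; zero; suc; _+_; _<_; _≤_; _<ᵇ_; _≡ᵇ_; z≤n; s≤s)
import Data.Nat as ℕ
open import Data.Nat.Properties
  using (+-0-commutativeMonoid; +-suc; suc-injective; +-identityʳ; +-cancelˡ-≡; +-assoc; ≤-trans; m≤n+m;
         <-cmp; <⇒≤; <⇒<ᵇ; <ᵇ⇒<; ≤⇒≯)
open import Data.Fin using (Fin; zero; suc; toℕ; fromℕ<; splitAt; join; cast)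
open import Data.Fin.Patterns using (0F; 1F; 2F; 3F)
open import Data.Fin.Properties using (_≟_; toℕ-injective; any?; all?; +↔⊎; splitAt-join; toℕ-cast)
open import Data.Fin.Permutation using (cast-id)
open import Data.Bool using (Bool; true; false; not; _∧_; _∨_; _xor_; if_then_else_)
import Data.Bool as Bool
open import Data.Bool.Properties
  using (not-involutive; not-distribʳ-xor; not-distribˡ-xor; xor-same; ∧-comm; ∨-comm; ∧-zeroʳ; ∧-identityʳ;
         ∨-identityʳ; T-≡)
open import Data.List using (map; allFin; tabulate)
open import Data.List.Properties using (map-tabulate)
import Data.Nat.ListAction as List
open import Data.Product using (∃; ∃₂; _×_; _,_; proj₁; proj₂)
open import Data.Sum using (_⊎_; inj₁; inj₂)
import Data.Sum
open import Data.Sum.Algebra using (⊎-cong; ⊎-comm; ⊎-assoc)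
open import Data.Empty using (⊥; ⊥-elim)
open import Function using (_∘_)
open import Function.Bundles using (_⇔_; mk⇔; _↔_; Inverse; mk↔ₛ′; Equivalence)
open import Function.Construct.Composition using (_↔-∘_)
open import Function.Construct.Symmetry using (↔-sym)
open import Function.Construct.Identity using (↔-id)
open import Level using (0ℓ)
open import Relation.Nullary using (¬_; Dec; yes; no; does)
open import Relation.Nullary.Decidable
  using (dec-true; dec-false; _×-dec_; _⊎-dec_; _→-dec_; map′; toWitness; ¬?; decidable-stable)
open import Relation.Binary using (tri<; tri≈; tri>)
open import Relation.Binary.PropositionalEquality
open import Algebra.Properties.CommutativeMonoid.Sum +-0-commutativeMonoid
  using (sum; sum-syntax; sum-cong-≗; ∑-distrib-+; ∑-comm; sum-permute)

⟦_⟧ : Bool → ℕ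
⟦ true ⟧ = 1
⟦ false ⟧ = 0

true≢false : true ≢ false
true≢false ()

∧-true : ∀ {a b} → a ∧ b ≡ true → a ≡ true × b ≡ true
∧-true {true} {true} _ = refl , refl

not-true : ∀ {b} → not b ≡ true → b ≡ false
not-true {false} _ = refl

∨-true : ∀ {a b} → a ∨ b ≡ true → a ≡ true ⊎ b ≡ true
∨-true {true} _ = inj₁ refl
∨-true {false} e = inj₂ e

∨-false : ∀ {a b} → a ∨ b ≡ false → a ≡ false × b ≡ false
∨-false {false} e = refl , e

xor-≢ : ∀ {x y} → x ≢ y → x xor y ≡ true
xor-≢ {true} {true} x≢y = ⊥-elim (x≢y refl)
xor-≢ {true} {false} _ = refl
xor-≢ {false} {true} _ = refl
xor-≢ {false} {false} x≢y = ⊥-elim (x≢y refl)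

if-1-0 : ∀ b → (if b then 1 else 0) ≡ ⟦ b ⟧
if-1-0 true = refl
if-1-0 false = refl

isLeft : ∀ {A B : Set} → A ⊎ B → Bool
isLeft (inj₁ _) = true
isLeft (inj₂ _) = false

≟-true : ∀ {n} {x y : Fin n} → does (x ≟ y) ≡ true → x ≡ y
≟-true {x = x} {y} e with x ≟ y
... | yes x≡y = x≡y

≟-false : ∀ {n} {x y : Fin n} → does (x ≟ y) ≡ false → x ≢ y
≟-false {x = x} {y} e with x ≟ y
... | no x≢y = x≢y

does-≟ : ∀ {n} (i j : Fin n) → does (i ≟ j) ≡ (toℕ i ≡ᵇ toℕ j)
does-≟ zero zero = refl
does-≟ zero (suc j) = refl
does-≟ (suc i) zero = refl
does-≟ (suc i) (suc j) = does-≟ i j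

_[_⇄_] : ∀ {n} → (Fin n → Fin n) → Fin n → Fin n → Fin n → Fin n
(q [ a ⇄ b ]) v = if does (v ≟ a) then b else if does (v ≟ b) then a else q v

⇄-cases : ∀ {n} (q : Fin n → Fin n) a b v →
  (v ≡ a × (q [ a ⇄ b ]) v ≡ b) ⊎ (v ≢ a × v ≡ b × (q [ a ⇄ b ]) v ≡ a) ⊎
  (v ≢ a × v ≢ b × (q [ a ⇄ b ]) v ≡ q v)
⇄-cases q a b v with v ≟ a | v ≟ b
... | yes v≡a | _ = inj₁ (v≡a , refl)
... | no v≢a | yes v≡b = inj₂ (inj₁ (v≢a , v≡b , refl))
... | no v≢a | no v≢b = inj₂ (inj₂ (v≢a , v≢b , refl))

⇄-left : ∀ {n} (q : Fin n → Fin n) a b → (q [ a ⇄ b ]) a ≡ b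
⇄-left q a b rewrite dec-true (a ≟ a) refl = refl

⇄-right : ∀ {n} (q : Fin n → Fin n) a b → (q [ a ⇄ b ]) b ≡ a
⇄-right q a b with b ≟ a
... | yes b≡a = b≡a
... | no _ rewrite dec-true (b ≟ b) refl = refl

⇄-other : ∀ {n} (q : Fin n → Fin n) {a b v} → v ≢ a → v ≢ b → (q [ a ⇄ b ]) v ≡ q v
⇄-other q {a} {b} {v} v≢a v≢b rewrite dec-false (v ≟ a) v≢a | dec-false (v ≟ b) v≢b = refl

<ᵇ-true : ∀ {m n} → m < n → (m <ᵇ n) ≡ true
<ᵇ-true m<n = Equivalence.to T-≡ (<⇒<ᵇ m<n)

<ᵇ-false : ∀ {m n} → n ≤ m → (m <ᵇ n) ≡ false
<ᵇ-false {m} {n} n≤m with m <ᵇ n in m<ᵇn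
... | false = refl
... | true = ⊥-elim (≤⇒≯ n≤m (<ᵇ⇒< m n (Equivalence.from T-≡ m<ᵇn)))

<ᵇ-splitAt : ∀ m {n} (k : Fin (m + n)) → (toℕ k <ᵇ m) ≡ isLeft (splitAt m k)
<ᵇ-splitAt zero k = refl
<ᵇ-splitAt (suc m) zero = refl
<ᵇ-splitAt (suc m) {n} (suc k) with splitAt m {n} k | <ᵇ-splitAt m {n} k
... | inj₁ _ | e = e
... | inj₂ _ | e = e

join-<ᵇ : ∀ m n (x : Fin m ⊎ Fin n) → (toℕ (join m n x) <ᵇ m) ≡ isLeft x
join-<ᵇ m n x = trans (<ᵇ-splitAt m (join m n x)) (cong isLeft (splitAt-join m n x))

double-injective : ∀ m n → m + m ≡ n + n → m ≡ n
double-injective zero zero e = refl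
double-injective (suc m) (suc n) e =
  cong suc (double-injective m n (suc-injective (trans (sym (+-suc m m)) (trans (suc-injective e) (+-suc n n)))))

sum-tabulate : ∀ n (f : Fin n → ℕ) → List.sum (tabulate f) ≡ sum f
sum-tabulate zero f = refl
sum-tabulate (suc n) f = cong (f zero +_) (sum-tabulate n (f ∘ suc))

sum-allFin : ∀ n (f : Fin n → ℕ) → List.sum (map f (allFin n)) ≡ sum f
sum-allFin n f = trans (cong List.sum (map-tabulate (λ i → i) f)) (sum-tabulate n f)

sum-zeros : ∀ n → ∑[ _ < n ] 0 ≡ 0
sum-zeros zero = refl
sum-zeros (suc n) = sum-zeros n

sum-ones : ∀ n → ∑[ _ < n ] 1 ≡ n
sum-ones zero = refl
sum-ones (suc n) = cong suc (sum-ones n)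

sum-at : ∀ {n} (y : Fin n) x → ∑[ v < n ] (if does (v ≟ y) then x else 0) ≡ x
sum-at {suc n} zero x = trans (cong (x +_) (sum-zeros n)) (+-identityʳ x)
sum-at {suc n} (suc y) x = sum-at y x

sum-single : ∀ {n} (y : Fin n) → ∑[ v < n ] ⟦ does (v ≟ y) ⟧ ≡ 1
sum-single y = trans (sum-cong-≗ (λ v → sym (if-1-0 (does (v ≟ y))))) (sum-at y 1)

sum-single-∧ : ∀ {n} (y : Fin n) b → ∑[ v < n ] ⟦ does (v ≟ y) ∧ b ⟧ ≡ ⟦ b ⟧
sum-single-∧ {n} y true = trans (sum-cong-≗ (λ v → cong ⟦_⟧ (∧-identityʳ (does (v ≟ y))))) (sum-single y)
sum-single-∧ {n} y false = trans (sum-cong-≗ (λ v → cong ⟦_⟧ (∧-zeroʳ (does (v ≟ y))))) (sum-zeros n)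

sum-complement : ∀ {n} (f : Fin n → Bool) → ∑[ v < n ] ⟦ not (f v) ⟧ + ∑[ v < n ] ⟦ f v ⟧ ≡ n
sum-complement {n} f = trans (sym (∑-distrib-+ (λ v → ⟦ not (f v) ⟧) (λ v → ⟦ f v ⟧)))
  (trans (sum-cong-≗ (λ v → one (f v))) (sum-ones n))
  where
  one : ∀ b → ⟦ not b ⟧ + ⟦ b ⟧ ≡ 1
  one true = refl
  one false = refl

sum-pair : ∀ {n} {u w : Fin n} → u ≢ w → ∑[ v < n ] ⟦ does (v ≟ u) ∨ does (v ≟ w) ⟧ ≡ 2
sum-pair {n} {u} {w} u≢w = trans (sum-cong-≗ split)
  (trans (∑-distrib-+ (λ v → ⟦ does (v ≟ u) ⟧) (λ v → ⟦ does (v ≟ w) ⟧)) (cong₂ _+_ (sum-single u) (sum-single w)))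
  where
  split : ∀ v → ⟦ does (v ≟ u) ∨ does (v ≟ w) ⟧ ≡ ⟦ does (v ≟ u) ⟧ + ⟦ does (v ≟ w) ⟧
  split v with v ≟ u | v ≟ w
  ... | yes refl | yes refl = ⊥-elim (u≢w refl)
  ... | yes _ | no _ = refl
  ... | no _ | yes _ = refl
  ... | no _ | no _ = refl

sum-positive : ∀ {n} (f : Fin n → Bool) {v} → f v ≡ true → 1 ≤ ∑[ u < n ] ⟦ f u ⟧
sum-positive {suc n} f {zero} e rewrite e = s≤s z≤n
sum-positive {suc n} f {suc v} e = ≤-trans (sum-positive (f ∘ suc) e) (m≤n+m _ ⟦ f zero ⟧)

sum-splitAt : ∀ m n (f : Fin m ⊎ Fin n → ℕ) →
              ∑[ k < m + n ] f (splitAt m k) ≡ ∑[ i < m ] f (inj₁ i) + ∑[ j < n ] f (inj₂ j)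
sum-splitAt zero n f = refl
sum-splitAt (suc m) n f =
  trans (cong (f (inj₁ zero) +_) (sum-splitAt m n (f ∘ Data.Sum.map₁ suc))) (sym (+-assoc (f (inj₁ zero)) _ _))

count-sides : ∀ m n (b : Bool → Bool) →
              ∑[ k < m + n ] ⟦ b (toℕ k <ᵇ m) ⟧ ≡ ∑[ _ < m ] ⟦ b true ⟧ + ∑[ _ < n ] ⟦ b false ⟧
count-sides m n b =
  trans (sum-cong-≗ (λ k → cong (⟦_⟧ ∘ b) (<ᵇ-splitAt m k))) (sum-splitAt m n (⟦_⟧ ∘ b ∘ isLeft))

count-left : ∀ m n → ∑[ k < m + n ] ⟦ toℕ k <ᵇ m ⟧ ≡ m
count-left m n = trans (count-sides m n (λ b → b)) (trans (cong₂ _+_ (sum-ones m) (sum-zeros n)) (+-identityʳ m))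

count-right : ∀ m n → ∑[ k < m + n ] ⟦ not (toℕ k <ᵇ m) ⟧ ≡ n
count-right m n = trans (count-sides m n not) (cong₂ _+_ (sum-zeros m) (sum-ones n))

-- Edge sets: degrees, the handshake lemma, minimality

module _ {G : Graph} where

  private
    N : ℕ
    N = vertices G

  mem-irrefl : (F : EdgeSet G) → ∀ i → mem F i i ≡ false
  mem-irrefl F i with mem F i i in eq
  ... | false = refl
  ... | true with () ← trans (sym (mem-sub F i i eq)) (adj-irr G i)

  degree : EdgeSet G → Fin N → ℕ
  degree F i = sum (λ j → ⟦ mem F i j ⟧)

  degree-one : (F : EdgeSet G) → ∀ {x y} → mem F x y ≡ true → (∀ k → mem F x k ≡ true → k ≡ y) →
               degree F x ≡ 1
  degree-one F {x} {y} xy unique = trans (sum-cong-≗ pointwise) (sum-single y)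
    where
    pointwise : ∀ j → ⟦ mem F x j ⟧ ≡ ⟦ does (j ≟ y) ⟧
    pointwise j with j ≟ y
    ... | yes refl = cong ⟦_⟧ xy
    ... | no j≢y with mem F x j in xj
    ...   | false = refl
    ...   | true = ⊥-elim (j≢y (unique j xj))

  private
    ordered : EdgeSet G → Fin N → Fin N → ℕ
    ordered F i j = ⟦ mem F i j ∧ (toℕ i <ᵇ toℕ j) ⟧

    card-ordered : (F : EdgeSet G) → card F ≡ sum (λ i → sum (λ j → ordered F i j))
    card-ordered F = trans (sum-allFin N _)
      (sum-cong-≗ {N} (λ i → trans (sum-allFin N _) (sum-cong-≗ {N} (λ j → if-1-0 _))))

    ordered-split : (F : EdgeSet G) → ∀ i j → ⟦ mem F i j ⟧ ≡ ordered F i j + ordered F j i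
    ordered-split F i j with <-cmp (toℕ i) (toℕ j)
    ... | tri< i<j _ _ rewrite <ᵇ-true i<j | <ᵇ-false (<⇒≤ i<j) | ∧-zeroʳ (mem F j i) | ∧-identityʳ (mem F i j)
      = sym (+-identityʳ _)
    ... | tri> _ _ j<i rewrite <ᵇ-true j<i | <ᵇ-false (<⇒≤ j<i) | ∧-zeroʳ (mem F i j) | ∧-identityʳ (mem F j i)
      = cong ⟦_⟧ (mem-sym F i j)
    ... | tri≈ _ i≡j _ rewrite toℕ-injective i≡j | mem-irrefl F j = refl

  handshake : (F : EdgeSet G) → card F + card F ≡ sum (degree F)
  handshake F = sym (begin
    sum (λ i → sum (λ j → ⟦ mem F i j ⟧))
      ≡⟨ sum-cong-≗ (λ i → trans (sum-cong-≗ (ordered-split F i))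
                                 (∑-distrib-+ (ordered F i) (λ j → ordered F j i))) ⟩
    sum (λ i → sum (ordered F i) + sum (λ j → ordered F j i))
      ≡⟨ ∑-distrib-+ (λ i → sum (ordered F i)) (λ i → sum (λ j → ordered F j i)) ⟩
    sum (λ i → sum (ordered F i)) + sum (λ i → sum (λ j → ordered F j i))
      ≡⟨ cong (sum (λ i → sum (ordered F i)) +_) (∑-comm (λ i j → ordered F j i)) ⟩
    sum (λ i → sum (ordered F i)) + sum (λ i → sum (ordered F i))
      ≡⟨ sym (cong₂ _+_ (card-ordered F) (card-ordered F)) ⟩
    card F + card F ∎)
    where open ≡-Reasoning

  EdgesAtAre : EdgeSet G → Fin N → Fin N → Fin N → Set
  EdgesAtAre F x y v = ∀ k → mem F v k ≡ true → (v ≡ x × k ≡ y) ⊎ (v ≡ y × k ≡ x)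

  private
    absent-at : ∀ {F F' : EdgeSet G} x y v → F' ⊆E F → mem F' x y ≡ false →
                EdgesAtAre F x y v → ∀ k → mem F' v k ≡ false
    absent-at {F' = F'} x y v F'⊆F F'xy only k with mem F' v k in F'vk
    ... | false = refl
    ... | true with only k (F'⊆F v k F'vk)
    ...   | inj₁ (refl , refl) = trans (sym F'vk) F'xy
    ...   | inj₂ (refl , refl) = trans (sym F'vk) (trans (mem-sym F' y x) F'xy)

  -- An edge ab of G dominated by xy and by no other edge of F makes xy indispensable.
  minimal-by-private-edges : (F : EdgeSet G) → IsEdgeDominating F →
    (∀ x y → mem F x y ≡ true →
      ∃₂ λ a b → adj G a b ≡ true × EdgesAtAre F x y a × EdgesAtAre F x y b) →
    IsMinimalEdgeDominating F
  minimal-by-private-edges F dom private-edge = dom , not-dominating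
    where
    not-dominating : ∀ F' → F' ⊂E F → ¬ IsEdgeDominating F'
    not-dominating F' (F'⊆F , x , y , Fxy , F'xy) dom'
      with private-edge x y Fxy
    ... | a , b , ab , only-a , only-b with dom' a b ab (absent-at {F} {F'} x y a F'⊆F F'xy only-a b)
    ...   | k , inj₁ F'ak = true≢false (trans (sym F'ak) (absent-at {F} {F'} x y a F'⊆F F'xy only-a k))
    ...   | k , inj₂ F'bk = true≢false (trans (sym F'bk) (absent-at {F} {F'} x y b F'⊆F F'xy only-b k))

  IsMatching : EdgeSet G → Set
  IsMatching F = ∀ {v k k'} → mem F v k ≡ true → mem F v k' ≡ true → k ≡ k'

  dominating-matching-minimal : (F : EdgeSet G) → IsMatching F → IsEdgeDominating F →
                                IsMinimalEdgeDominating F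
  dominating-matching-minimal F matching dom = minimal-by-private-edges F dom
    λ x y Fxy → x , y , mem-sub F x y Fxy
              , (λ k Fxk → inj₁ (refl , matching Fxk Fxy))
              , (λ k Fyk → inj₂ (refl , matching Fyk (trans (mem-sym F y x) Fxy)))

samePair : ∀ {n} → Fin n → Fin n → Fin n → Fin n → Bool
samePair x y i j = (does (i ≟ x) ∧ does (j ≟ y)) ∨ (does (i ≟ y) ∧ does (j ≟ x))

samePair-sym : ∀ {n} (x y i j : Fin n) → samePair x y i j ≡ samePair x y j i
samePair-sym x y i j = trans (∨-comm (does (i ≟ x) ∧ does (j ≟ y)) _)
  (cong₂ _∨_ (∧-comm (does (i ≟ y)) _) (∧-comm (does (i ≟ x)) _))

without : ∀ {n} → (Fin n → Fin n → Bool) → Fin n → Fin n → Fin n → Fin n → Bool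
without m x y i j = m i j ∧ not (samePair x y i j)

module _ {G : Graph} where

  private
    N : ℕ
    N = vertices G

  remove : EdgeSet G → Fin N → Fin N → EdgeSet G
  remove F x y = record
    { mem = without (mem F) x y
    ; mem-sym = λ i j → cong₂ (λ e p → e ∧ not p) (mem-sym F i j) (samePair-sym x y i j)
    ; mem-sub = λ i j e → mem-sub F i j (proj₁ (∧-true e))
    }

  remove-⊂ : (F : EdgeSet G) → ∀ {x y} → mem F x y ≡ true → remove F x y ⊂E F
  remove-⊂ F {x} {y} Fxy = (λ i j e → proj₁ (∧-true e)) , x , y , Fxy , removed
    where
    removed : mem (remove F x y) x y ≡ false
    removed rewrite dec-true (x ≟ x) refl | dec-true (y ≟ y) refl = ∧-zeroʳ (mem F x y)

  remove-keeps : (F : EdgeSet G) → ∀ {x y i j} → mem F i j ≡ true →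
                 ¬ (i ≡ x × j ≡ y) → ¬ (i ≡ y × j ≡ x) → mem (remove F x y) i j ≡ true
  remove-keeps F {x} {y} {i} {j} Fij ≢xy ≢yx with i ≟ x | j ≟ y | i ≟ y | j ≟ x
  ... | yes refl | yes refl | _ | _ = ⊥-elim (≢xy (refl , refl))
  ... | _ | _ | yes refl | yes refl = ⊥-elim (≢yx (refl , refl))
  ... | no _ | _ | no _ | _ = trans (∧-identityʳ _) Fij
  ... | no _ | _ | yes _ | no _ = trans (∧-identityʳ _) Fij
  ... | yes _ | no _ | no _ | _ = trans (∧-identityʳ _) Fij
  ... | yes _ | no _ | yes _ | no _ = trans (∧-identityʳ _) Fij

  minimal-remove : (F : EdgeSet G) → IsMinimalEdgeDominating F →
                   ∀ {x y} → mem F x y ≡ true → ¬ IsEdgeDominating (remove F x y)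
  minimal-remove F (_ , minimal) {x} {y} Fxy = minimal (remove F x y) (remove-⊂ F Fxy)

  Covered : EdgeSet G → Fin N → Set
  Covered F i = ∃ λ k → mem F i k ≡ true

  covered? : (F : EdgeSet G) → ∀ i → Dec (Covered F i)
  covered? F i = any? (λ k → mem F i k Bool.≟ true)

reach-induction : ∀ {G} (P : Fin (vertices G) → Set) → (∀ {z z'} → P z → adj G z z' ≡ true → P z') →
                  ∀ {u v} → Reach G u v → P u → P v
reach-induction P preserve here Pu = Pu
reach-induction P preserve (step u~w w→v) Pu = reach-induction P preserve w→v (preserve Pu u~w)

-- Matchings given by partner functions

-- The partner of an exposed (unmatched) vertex is junk.
record Pairing (G : Graph) : Set where
  field
    partner : Fin (vertices G) → Fin (vertices G)
    exposed : Fin (vertices G) → Bool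
    partner-adj : ∀ v → exposed v ≡ false → adj G v (partner v) ≡ true
    partner-involutive : ∀ v → exposed v ≡ false → partner (partner v) ≡ v
    partner-matched : ∀ v → exposed v ≡ false → exposed (partner v) ≡ false

module _ {G : Graph} (P : Pairing G) where

  open Pairing P
  private
    N : ℕ
    N = vertices G

  ExposedIndependent : Set
  ExposedIndependent = ∀ u w → exposed u ≡ true → exposed w ≡ true → adj G u w ≡ false

  exposed-count : ℕ
  exposed-count = ∑[ v < N ] ⟦ exposed v ⟧

  private
    edge : Fin N → Fin N → Bool
    edge i j = not (exposed i) ∧ does (j ≟ partner i)

    edge-elim : ∀ {i j} → edge i j ≡ true → exposed i ≡ false × j ≡ partner i
    edge-elim {i} {j} e with exposed i in ei | j ≟ partner i
    ... | false | yes j≡ = refl , j≡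
    ... | false | no _ with () ← e

    edge-intro : ∀ {i} → exposed i ≡ false → edge i (partner i) ≡ true
    edge-intro {i} ei rewrite ei | dec-true (partner i ≟ partner i) refl = refl

    edge-flip : ∀ {i j} → edge i j ≡ true → edge j i ≡ true
    edge-flip {i} {j} e with edge-elim {i} {j} e
    ... | ei , refl = subst (λ k → edge (partner i) k ≡ true) (partner-involutive i ei)
                            (edge-intro (partner-matched i ei))

    edge-sym : ∀ i j → edge i j ≡ edge j i
    edge-sym i j with edge i j in eij | edge j i in eji
    ... | true | true = refl
    ... | false | false = refl
    ... | true | false = trans (sym (edge-flip eij)) eji
    ... | false | true = trans (sym eij) (edge-flip eji)

  pairingEdges : EdgeSet G
  pairingEdges = record
    { mem = edge
    ; mem-sym = edge-sym
    ; mem-sub = λ i j e → let ei , j≡ = edge-elim e in subst (λ k → adj G i k ≡ true) (sym j≡) (partner-adj i ei)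
    }

  pairingEdges-matching : IsMatching pairingEdges
  pairingEdges-matching e e' = trans (proj₂ (edge-elim e)) (sym (proj₂ (edge-elim e')))

  pairingEdges-dominating : ExposedIndependent → IsEdgeDominating pairingEdges
  pairingEdges-dominating independent u w uw _ = cover (exposed u) refl (exposed w) refl
    where
    cover : ∀ bu → exposed u ≡ bu → ∀ bw → exposed w ≡ bw →
            ∃ λ k → (edge u k ≡ true) ⊎ (edge w k ≡ true)
    cover false eu _ _ = partner u , inj₁ (edge-intro eu)
    cover true _ false ew = partner w , inj₂ (edge-intro ew)
    cover true eu true ew with () ← trans (sym uw) (independent u w eu ew)

  pairingEdges-degree : ∀ v → degree pairingEdges v ≡ ⟦ not (exposed v) ⟧
  pairingEdges-degree v = by-exposure (exposed v) refl
    where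
    by-exposure : ∀ b → exposed v ≡ b → degree pairingEdges v ≡ ⟦ not b ⟧
    by-exposure false ev = degree-one pairingEdges (edge-intro ev) (λ k e → proj₂ (edge-elim e))
    by-exposure true ev =
      trans (sum-cong-≗ (λ j → cong (λ b → ⟦ not b ∧ does (j ≟ partner v) ⟧) ev)) (sum-zeros N)

  pairingEdges-card : card pairingEdges + card pairingEdges + exposed-count ≡ N
  pairingEdges-card = begin
    card pairingEdges + card pairingEdges + exposed-count
      ≡⟨ cong (_+ exposed-count) (trans (handshake pairingEdges) (sum-cong-≗ pairingEdges-degree)) ⟩
    ∑[ v < N ] ⟦ not (exposed v) ⟧ + exposed-count
      ≡⟨ sum-complement exposed ⟩
    N ∎
    where open ≡-Reasoning

-- Maximal matchings are minimal edge dominating sets, so they all have the same size.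
well-edge-dominated-exposed-count : {G : Graph} → WellEdgeDominated G → (P Q : Pairing G) →
  ExposedIndependent P → ExposedIndependent Q → exposed-count P ≡ exposed-count Q
well-edge-dominated-exposed-count {G} wed P Q indP indQ =
  +-cancelˡ-≡ (card (pairingEdges P) + card (pairingEdges P)) (exposed-count P) (exposed-count Q) (begin
    card (pairingEdges P) + card (pairingEdges P) + exposed-count P ≡⟨ pairingEdges-card P ⟩
    vertices G                                                    ≡⟨ pairingEdges-card Q ⟨
    card (pairingEdges Q) + card (pairingEdges Q) + exposed-count Q ≡⟨ cong (λ c → c + c + exposed-count Q) same-card ⟨
    card (pairingEdges P) + card (pairingEdges P) + exposed-count Q ∎)
  where
  open ≡-Reasoning
  minimal : (R : Pairing G) → ExposedIndependent R → IsMinimalEdgeDominating (pairingEdges R)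
  minimal R indR = dominating-matching-minimal (pairingEdges R) (pairingEdges-matching R) (pairingEdges-dominating R indR)
  same-card : card (pairingEdges P) ≡ card (pairingEdges Q)
  same-card = wed (pairingEdges P) (pairingEdges Q) (minimal P indP) (minimal Q indQ)

-- Invariance under isomorphism

module Isomorphism {G H : Graph} (φ : G ≅ H) where

  private
    π : Fin (vertices G) ↔ Fin (vertices H)
    π = proj₁ φ
    to : Fin (vertices G) → Fin (vertices H)
    to = Inverse.to π
    from : Fin (vertices H) → Fin (vertices G)
    from = Inverse.from π

    to-from : ∀ a → to (from a) ≡ a
    to-from a = Inverse.strictlyInverseˡ π a

    from-to : ∀ i → from (to i) ≡ i
    from-to i = Inverse.strictlyInverseʳ π i

    adj-from : ∀ a b → adj H a b ≡ adj G (from a) (from b)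
    adj-from a b = trans (cong₂ (adj H) (sym (to-from a)) (sym (to-from b))) (sym (proj₂ φ (from a) (from b)))

  pull : EdgeSet H → EdgeSet G
  pull F = record
    { mem = λ i j → mem F (to i) (to j)
    ; mem-sym = λ i j → mem-sym F (to i) (to j)
    ; mem-sub = λ i j e → trans (proj₂ φ i j) (mem-sub F (to i) (to j) e)
    }

  push : EdgeSet G → EdgeSet H
  push F = record
    { mem = λ a b → mem F (from a) (from b)
    ; mem-sym = λ a b → mem-sym F (from a) (from b)
    ; mem-sub = λ a b e → trans (adj-from a b) (mem-sub F (from a) (from b) e)
    }

  push-dominating : (F : EdgeSet G) → IsEdgeDominating F → IsEdgeDominating (push F)
  push-dominating F dom a b ab Fab with dom (from a) (from b) (trans (sym (adj-from a b)) ab) Fab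
  ... | k , inj₁ e = to k , inj₁ (trans (cong (mem F (from a)) (from-to k)) e)
  ... | k , inj₂ e = to k , inj₂ (trans (cong (mem F (from b)) (from-to k)) e)

  pull-dominating : (F : EdgeSet H) → IsEdgeDominating F → IsEdgeDominating (pull F)
  pull-dominating F dom i j ij Fij with dom (to i) (to j) (trans (sym (proj₂ φ i j)) ij) Fij
  ... | k , inj₁ e = from k , inj₁ (trans (cong (mem F (to i)) (to-from k)) e)
  ... | k , inj₂ e = from k , inj₂ (trans (cong (mem F (to j)) (to-from k)) e)

  pull-⊂ : (F : EdgeSet G) (F' : EdgeSet H) → F' ⊂E push F → pull F' ⊂E F
  pull-⊂ F F' (F'⊆ , a , b , Fab , F'ab) =
    (λ i j e → trans (sym (cong₂ (mem F) (from-to i) (from-to j))) (F'⊆ (to i) (to j) e)) ,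
    (from a , from b , Fab , trans (cong₂ (mem F') (to-from a) (to-from b)) F'ab)

  push-minimal : (F : EdgeSet G) → IsMinimalEdgeDominating F → IsMinimalEdgeDominating (push F)
  push-minimal F (dom , minimal) =
    push-dominating F dom , λ F' F'⊂ dom' → minimal (pull F') (pull-⊂ F F' F'⊂) (pull-dominating F' dom')

  card-push : (F : EdgeSet G) → card F ≡ card (push F)
  card-push F = double-injective _ _ (begin
    card F + card F                   ≡⟨ handshake F ⟩
    sum (degree F)                    ≡⟨ sum-permute (degree F) (↔-sym π) ⟩
    sum (λ a → degree F (from a))
      ≡⟨ sum-cong-≗ (λ a → sum-permute (λ j → ⟦ mem F (from a) j ⟧) (↔-sym π)) ⟩
    sum (degree (push F))             ≡⟨ handshake (push F) ⟨
    card (push F) + card (push F)     ∎)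
    where open ≡-Reasoning

well-edge-dominated-≅ : ∀ {G} H → G ≅ H → WellEdgeDominated H → WellEdgeDominated G
well-edge-dominated-≅ H φ wed F F' minF minF' =
  trans (card-push F) (trans (wed (push F) (push F') (push-minimal F minF) (push-minimal F' minF')) (sym (card-push F')))
  where open Isomorphism {H = H} φ

-- Complete bipartite graphs

module CompleteBipartite (G : Graph) (side : Fin (vertices G) → Bool)
                         (bipartite : ∀ i j → adj G i j ≡ side i xor side j) where

  private
    N : ℕ
    N = vertices G

  size : ℕ
  size = sum (λ i → ⟦ side i ⟧)

  SideCovered : EdgeSet G → Set
  SideCovered F = ∀ i → side i ≡ true → Covered F i

  flipped : ∀ i j → adj G i j ≡ not (side i) xor not (side j)
  flipped i j = trans (bipartite i j)
    (trans (sym (not-involutive _))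
      (trans (cong not (not-distribʳ-xor (side i) (side j))) (not-distribˡ-xor (side i) (not (side j)))))

  private
    sides : ∀ {i j} → adj G i j ≡ true → (side i ≡ true × side j ≡ false) ⊎ (side i ≡ false × side j ≡ true)
    sides {i} {j} ij with side i | side j | trans (sym (bipartite i j)) ij
    ... | true | false | _ = inj₁ (refl , refl)
    ... | false | true | _ = inj₂ (refl , refl)

  dominating-covers-a-side : (F : EdgeSet G) → IsEdgeDominating F →
    SideCovered F ⊎ (∀ i → not (side i) ≡ true → Covered F i)
  dominating-covers-a-side F dom with any? (λ u → (side u Bool.≟ true) ×-dec ¬? (covered? F u))
  ... | no none = inj₁ λ i si → decidable-stable (covered? F i) (λ uncovered → none (i , si , uncovered))
  ... | yes (u , su , u-uncovered) = inj₂ covered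
    where
    covered : ∀ i → not (side i) ≡ true → Covered F i
    covered i si with mem F u i in Fui
    ... | true = ⊥-elim (u-uncovered (i , Fui))
    ... | false with dom u i (trans (bipartite u i) (cong₂ _xor_ su (not-true si))) Fui
    ...   | k , inj₁ Fuk = ⊥-elim (u-uncovered (k , Fuk))
    ...   | k , inj₂ Fik = k , Fik

  minimal-side-degree : (F : EdgeSet G) → IsMinimalEdgeDominating F → SideCovered F →
                        ∀ x → side x ≡ true → degree F x ≡ 1
  minimal-side-degree F minF cover x sx with cover x sx
  ... | y , Fxy = degree-one F Fxy unique
    where
    sy : side y ≡ false
    sy with sides (mem-sub F x y Fxy)
    ... | inj₁ (_ , sy) = sy
    ... | inj₂ (sx' , _) = ⊥-elim (true≢false (trans (sym sx) sx'))

    not-y : ∀ {c} → side c ≡ true → c ≢ y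
    not-y sc refl = true≢false (trans (sym sc) sy)

    -- With a second F-neighbour k of x, F − xy still covers the whole side, hence still dominates.
    still-covered : ∀ k → mem F x k ≡ true → k ≢ y → SideCovered (remove F x y)
    still-covered k Fxk k≢y c sc = choose (c ≟ x) (cover c sc)
      where
      choose : Dec (c ≡ x) → Covered F c → Covered (remove F x y) c
      choose (yes refl) _ = k , remove-keeps F Fxk (k≢y ∘ proj₂) (not-y sx ∘ proj₁)
      choose (no c≢x) (d , Fcd) = d , remove-keeps F Fcd (c≢x ∘ proj₁) (not-y sc ∘ proj₁)

    still-dominating : ∀ k → mem F x k ≡ true → k ≢ y → IsEdgeDominating (remove F x y)
    still-dominating k Fxk k≢y a b ab _ with sides ab
    ... | inj₁ (sa , _) = let c , e = still-covered k Fxk k≢y a sa in c , inj₁ e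
    ... | inj₂ (_ , sb) = let c , e = still-covered k Fxk k≢y b sb in c , inj₂ e

    unique : ∀ k → mem F x k ≡ true → k ≡ y
    unique k Fxk with k ≟ y
    ... | yes k≡y = k≡y
    ... | no k≢y = ⊥-elim (minimal-remove F minF Fxy (still-dominating k Fxk k≢y))

  private
    fromSide : EdgeSet G → Fin N → Fin N → ℕ
    fromSide F i j = ⟦ mem F i j ∧ side i ⟧

    fromSide-split : (F : EdgeSet G) → ∀ i j → ⟦ mem F i j ⟧ ≡ fromSide F i j + fromSide F j i
    fromSide-split F i j with mem F i j in Fij
    ... | false rewrite mem-sym F j i | Fij = refl
    ... | true rewrite mem-sym F j i | Fij with sides (mem-sub F i j Fij)
    ...   | inj₁ (si , sj) rewrite si | sj = refl
    ...   | inj₂ (si , sj) rewrite si | sj = refl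

  side-degree-card : (F : EdgeSet G) → (∀ x → side x ≡ true → degree F x ≡ 1) → card F ≡ size
  side-degree-card F deg₁ = double-injective _ _ (begin
    card F + card F
      ≡⟨ handshake F ⟩
    sum (λ i → sum (λ j → ⟦ mem F i j ⟧))
      ≡⟨ sum-cong-≗ (λ i → trans (sum-cong-≗ (fromSide-split F i))
                                 (∑-distrib-+ (fromSide F i) (λ j → fromSide F j i))) ⟩
    sum (λ i → sum (fromSide F i) + sum (λ j → fromSide F j i))
      ≡⟨ ∑-distrib-+ (λ i → sum (fromSide F i)) (λ i → sum (λ j → fromSide F j i)) ⟩
    sum (λ i → sum (fromSide F i)) + sum (λ i → sum (λ j → fromSide F j i))
      ≡⟨ cong (sum (λ i → sum (fromSide F i)) +_) (∑-comm (λ i j → fromSide F j i)) ⟩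
    sum (λ i → sum (fromSide F i)) + sum (λ i → sum (fromSide F i))
      ≡⟨ cong₂ _+_ (sum-cong-≗ row) (sum-cong-≗ row) ⟩
    size + size ∎)
    where
    open ≡-Reasoning
    row : ∀ i → sum (fromSide F i) ≡ ⟦ side i ⟧
    row i with side i in si
    ... | true = trans (sum-cong-≗ (λ j → cong ⟦_⟧ (∧-identityʳ (mem F i j)))) (deg₁ i si)
    ... | false = trans (sum-cong-≗ (λ j → cong ⟦_⟧ (∧-zeroʳ (mem F i j)))) (sum-zeros N)

module _ (G : Graph) (side : Fin (vertices G) → Bool)
         (bipartite : ∀ i j → adj G i j ≡ side i xor side j) where

  open CompleteBipartite G side bipartite
  private
    module Other = CompleteBipartite G (not ∘ side) flipped

  minimal-card-complete-bipartite : (F : EdgeSet G) → IsMinimalEdgeDominating F → card F ≡ size ⊎ card F ≡ Other.size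
  minimal-card-complete-bipartite F minF with dominating-covers-a-side F (proj₁ minF)
  ... | inj₁ cover = inj₁ (side-degree-card F (minimal-side-degree F minF cover))
  ... | inj₂ cover = inj₂ (Other.side-degree-card F (Other.minimal-side-degree F minF cover))

  balanced-complete-bipartite-well-edge-dominated : size ≡ Other.size → WellEdgeDominated G
  balanced-complete-bipartite-well-edge-dominated balanced F F' minF minF'
    with minimal-card-complete-bipartite F minF | minimal-card-complete-bipartite F' minF'
  ... | inj₁ e | inj₁ e' = trans e (sym e')
  ... | inj₁ e | inj₂ e' = trans e (trans balanced (sym e'))
  ... | inj₂ e | inj₁ e' = trans e (trans (sym balanced) (sym e'))
  ... | inj₂ e | inj₂ e' = trans e (sym e')

Knn-well-edge-dominated : ∀ n → WellEdgeDominated (Knn n)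
Knn-well-edge-dominated n = balanced-complete-bipartite-well-edge-dominated (Knn n) (λ i → toℕ i <ᵇ n) (λ _ _ → refl)
  (trans (count-left n n) (sym (count-right n n)))

-- The complete graph K4

-- IsEdgeDominating F unfolds to Dominates G (mem F); this form also applies to raw tables.
Dominates : (G : Graph) → (Fin (vertices G) → Fin (vertices G) → Bool) → Set
Dominates G m = ∀ i j → adj G i j ≡ true → m i j ≡ false → ∃ λ k → (m i k ≡ true) ⊎ (m j k ≡ true)

dominates? : ∀ G m → Dec (Dominates G m)
dominates? G m = all? λ i → all? λ j → (adj G i j Bool.≟ true) →-dec (m i j Bool.≟ false) →-dec
  any? λ k → (m i k Bool.≟ true) ⊎-dec (m j k Bool.≟ true)

dominates-cong : ∀ G {m m'} → (∀ i j → m i j ≡ m' i j) → Dominates G m → Dominates G m'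
dominates-cong G {m} {m'} m≗m' dom i j ij m'ij with dom i j ij (trans (m≗m' i j) m'ij)
... | k , inj₁ mik = k , inj₁ (trans (sym (m≗m' i k)) mik)
... | k , inj₂ mjk = k , inj₂ (trans (sym (m≗m' j k)) mjk)

∀-Bool? : {P : Bool → Set} → (∀ b → Dec (P b)) → Dec (∀ b → P b)
∀-Bool? P? = map′ (λ (t , f) → λ { true → t ; false → f }) (λ p → p true , p false) (P? true ×-dec P? false)

K4-table : Bool → Bool → Bool → Bool → Bool → Bool → Fin 4 → Fin 4 → Bool
K4-table b01 b02 b03 b12 b13 b23 = λ where
  0F 1F → b01 ; 1F 0F → b01 ; 0F 2F → b02 ; 2F 0F → b02 ; 0F 3F → b03 ; 3F 0F → b03
  1F 2F → b12 ; 2F 1F → b12 ; 1F 3F → b13 ; 3F 1F → b13 ; 2F 3F → b23 ; 3F 2F → b23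
  _ _ → false

Irredundant : (Fin 4 → Fin 4 → Bool) → Set
Irredundant t = Dominates K4 t × (∀ x y → t x y ≡ true → ¬ Dominates K4 (without t x y))

irredundant? : ∀ t → Dec (Irredundant t)
irredundant? t = dominates? K4 t ×-dec
  all? λ x → all? λ y → (t x y Bool.≟ true) →-dec ¬? (dominates? K4 (without t x y))

-- Decided by evaluation over all 2⁶ edge sets of K4.
K4-irredundant-two-edges : ∀ b01 b02 b03 b12 b13 b23 → let t = K4-table b01 b02 b03 b12 b13 b23 in
  Irredundant t → ∑[ i < 4 ] ∑[ j < 4 ] ⟦ t i j ⟧ ≡ 4
K4-irredundant-two-edges = toWitness {a? =
  ∀-Bool? λ b01 → ∀-Bool? λ b02 → ∀-Bool? λ b03 → ∀-Bool? λ b12 → ∀-Bool? λ b13 → ∀-Bool? λ b23 →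
  let t = K4-table b01 b02 b03 b12 b13 b23 in irredundant? t →-dec (∑[ i < 4 ] ∑[ j < 4 ] ⟦ t i j ⟧ ℕ.≟ 4)} _

module _ (F : EdgeSet K4) where
  private
    t : Fin 4 → Fin 4 → Bool
    t = K4-table (mem F 0F 1F) (mem F 0F 2F) (mem F 0F 3F) (mem F 1F 2F) (mem F 1F 3F) (mem F 2F 3F)

    as-table : ∀ i j → mem F i j ≡ t i j
    as-table 0F 0F = mem-irrefl F 0F
    as-table 1F 1F = mem-irrefl F 1F
    as-table 2F 2F = mem-irrefl F 2F
    as-table 3F 3F = mem-irrefl F 3F
    as-table 0F 1F = refl
    as-table 0F 2F = refl
    as-table 0F 3F = refl
    as-table 1F 2F = refl
    as-table 1F 3F = refl
    as-table 2F 3F = refl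
    as-table 1F 0F = mem-sym F 1F 0F
    as-table 2F 0F = mem-sym F 2F 0F
    as-table 3F 0F = mem-sym F 3F 0F
    as-table 2F 1F = mem-sym F 2F 1F
    as-table 3F 1F = mem-sym F 3F 1F
    as-table 3F 2F = mem-sym F 3F 2F

  K4-minimal-card : IsMinimalEdgeDominating F → card F ≡ 2
  K4-minimal-card minF = double-injective _ 2 (begin
    card F + card F                      ≡⟨ handshake F ⟩
    ∑[ i < 4 ] ∑[ j < 4 ] ⟦ mem F i j ⟧
      ≡⟨ sum-cong-≗ (λ i → sum-cong-≗ (λ j → cong ⟦_⟧ (as-table i j))) ⟩
    ∑[ i < 4 ] ∑[ j < 4 ] ⟦ t i j ⟧
      ≡⟨ K4-irredundant-two-edges _ _ _ _ _ _ (dominates-cong K4 as-table (proj₁ minF) , irredundant) ⟩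
    4                                    ∎)
    where
    open ≡-Reasoning
    irredundant : ∀ x y → t x y ≡ true → ¬ Dominates K4 (without t x y)
    irredundant x y txy = minimal-remove F minF (trans (as-table x y) txy)
      ∘ dominates-cong K4 (λ i j → cong (λ b → b ∧ not (samePair x y i j)) (sym (as-table i j)))

K4-well-edge-dominated : WellEdgeDominated K4
K4-well-edge-dominated F F' minF minF' = trans (K4-minimal-card F minF) (sym (K4-minimal-card F' minF'))

-- Well-edge-dominated graphs with a perfect matching

record PerfectPairing (G : Graph) : Set where
  field
    partner : Fin (vertices G) → Fin (vertices G)
    partner-adj : ∀ v → adj G v (partner v) ≡ true
    partner-involutive : ∀ v → partner (partner v) ≡ v

module _ {G : Graph} (Q : PerfectPairing G) where

  open PerfectPairing Q

  asPairing : Pairing G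
  asPairing = record
    { partner = partner
    ; exposed = λ _ → false
    ; partner-adj = λ v _ → partner-adj v
    ; partner-involutive = λ v _ → partner-involutive v
    ; partner-matched = λ _ _ → refl
    }

  perfect-pairing-card : card (pairingEdges asPairing) + card (pairingEdges asPairing) ≡ vertices G
  perfect-pairing-card = trans (sym (trans (cong (c + c +_) (sum-zeros (vertices G))) (+-identityʳ (c + c))))
                               (pairingEdges-card asPairing)
    where
    c : ℕ
    c = card (pairingEdges asPairing)

  partner-injective : ∀ {a b} → partner a ≡ partner b → a ≡ b
  partner-injective {a} {b} e = trans (sym (partner-involutive a)) (trans (cong partner e) (partner-involutive b))

  partner-flip : ∀ {a b} → partner a ≡ b → a ≡ partner b
  partner-flip {a} e = trans (sym (partner-involutive a)) (cong partner e)

  partner-≢ : ∀ v → partner v ≢ v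
  partner-≢ v e with () ← trans (sym (partner-adj v)) (trans (cong (adj G v) e) (adj-irr G v))

perfectMatchingPairing : {G : Graph} (M : EdgeSet G) → IsPerfectMatching M → PerfectPairing G
perfectMatchingPairing M perfect = record
  { partner = λ v → proj₁ (perfect v)
  ; partner-adj = λ v → mem-sub M v _ (proj₁ (proj₂ (perfect v)))
  ; partner-involutive = λ v → let u , Mvu , _ = perfect v in
      sym (proj₂ (proj₂ (perfect u)) v (trans (mem-sym M u v) Mvu))
  }

module _ {G : Graph} (wed : WellEdgeDominated G) (Q : PerfectPairing G) where

  open PerfectPairing Q renaming (partner to q)
  private
    V : Set
    V = Fin (vertices G)

    module Exposing {u w : V} (u≢w : u ≢ w) (u≁w : adj G u w ≡ false) (qu~qw : adj G (q u) (q w) ≡ true) where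

      exposed : V → Bool
      exposed v = does (v ≟ u) ∨ does (v ≟ w)

      unexposed : ∀ {x} → x ≢ u → x ≢ w → exposed x ≡ false
      unexposed {x} x≢u x≢w rewrite dec-false (x ≟ u) x≢u | dec-false (x ≟ w) x≢w = refl

      qw≢u : q w ≢ u
      qw≢u qw≡u with () ← trans (sym u≁w)
        (trans (cong (λ y → adj G y w) (sym qw≡u)) (trans (adj-sym G (q w) w) (partner-adj w)))

      qu≢w : q u ≢ w
      qu≢w qu≡w = qw≢u (trans (cong q (sym qu≡w)) (partner-involutive u))

      pairing : Pairing G
      pairing = record
        { partner = q [ q u ⇄ q w ]
        ; exposed = exposed
        ; partner-adj = partner-adj′
        ; partner-involutive = involutive
        ; partner-matched = matched
        }
        where
        partner-adj′ : ∀ v → exposed v ≡ false → adj G v ((q [ q u ⇄ q w ]) v) ≡ true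
        partner-adj′ v _ with ⇄-cases q (q u) (q w) v
        ... | inj₁ (refl , e) = trans (cong (adj G (q u)) e) qu~qw
        ... | inj₂ (inj₁ (_ , refl , e)) = trans (cong (adj G (q w)) e) (trans (adj-sym G (q w) (q u)) qu~qw)
        ... | inj₂ (inj₂ (_ , _ , e)) = trans (cong (adj G v) e) (partner-adj v)

        involutive : ∀ v → exposed v ≡ false → (q [ q u ⇄ q w ]) ((q [ q u ⇄ q w ]) v) ≡ v
        involutive v ev with ⇄-cases q (q u) (q w) v
        ... | inj₁ (refl , e) = trans (cong (q [ q u ⇄ q w ]) e) (⇄-right q (q u) (q w))
        ... | inj₂ (inj₁ (_ , refl , e)) = trans (cong (q [ q u ⇄ q w ]) e) (⇄-left q (q u) (q w))
        ... | inj₂ (inj₂ (v≢qu , v≢qw , e)) = trans (cong (q [ q u ⇄ q w ]) e)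
          (trans (⇄-other q (v≢u ∘ partner-injective Q) (v≢w ∘ partner-injective Q)) (partner-involutive v))
          where
          v≢u : v ≢ u
          v≢u = ≟-false (proj₁ (∨-false ev))
          v≢w : v ≢ w
          v≢w = ≟-false (proj₂ (∨-false ev))

        matched : ∀ v → exposed v ≡ false → exposed ((q [ q u ⇄ q w ]) v) ≡ false
        matched v ev with ⇄-cases q (q u) (q w) v
        ... | inj₁ (refl , e) = subst (λ x → exposed x ≡ false) (sym e)
          (unexposed qw≢u (partner-≢ Q w))
        ... | inj₂ (inj₁ (_ , refl , e)) = subst (λ x → exposed x ≡ false) (sym e)
          (unexposed (partner-≢ Q u) qu≢w)
        ... | inj₂ (inj₂ (v≢qu , v≢qw , e)) = subst (λ x → exposed x ≡ false) (sym e)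
          (unexposed (v≢qu ∘ partner-flip Q) (v≢qw ∘ partner-flip Q))

      exposed-elim : ∀ {x} → exposed x ≡ true → x ≡ u ⊎ x ≡ w
      exposed-elim ex with ∨-true ex
      ... | inj₁ x≡u = inj₁ (≟-true x≡u)
      ... | inj₂ x≡w = inj₂ (≟-true x≡w)

      independent : ExposedIndependent pairing
      independent a b ea eb with exposed-elim {a} ea | exposed-elim {b} eb
      ... | inj₁ refl | inj₁ refl = adj-irr G u
      ... | inj₁ refl | inj₂ refl = u≁w
      ... | inj₂ refl | inj₁ refl = trans (adj-sym G w u) u≁w
      ... | inj₂ refl | inj₂ refl = adj-irr G w

  -- Otherwise unmatching u and w and matching qu with qw leaves a maximal matching missing two vertices.
  perfect-pairing-preserves-nonadjacency : ∀ {u w} → u ≢ w → adj G u w ≡ false → adj G (q u) (q w) ≡ false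
  perfect-pairing-preserves-nonadjacency {u} {w} u≢w u≁w with adj G (q u) (q w) in qu~qw
  ... | false = refl
  ... | true with () ← trans (sym (sum-pair u≢w))
        (trans (well-edge-dominated-exposed-count wed (Exposing.pairing u≢w u≁w qu~qw) (asPairing Q)
                  (Exposing.independent u≢w u≁w qu~qw) (λ _ _ ()))
               (sum-zeros (vertices G)))

module PerfectlyPaired {G : Graph} (wed : WellEdgeDominated G) (Q : PerfectPairing G) where

  open PerfectPairing Q renaming (partner to p)

  V : Set
  V = Fin (vertices G)

  _~_ : V → V → Set
  a ~ b = adj G a b ≡ true

  ~-sym : ∀ {a b} → a ~ b → b ~ a
  ~-sym {a} {b} e = trans (adj-sym G b a) e

  ~-≢ : ∀ {a b} → a ~ b → a ≢ b
  ~-≢ {a} a~b refl with () ← trans (sym a~b) (adj-irr G a)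

  partner-preserves-adj : ∀ a b → adj G (p a) (p b) ≡ adj G a b
  partner-preserves-adj a b with adj G a b in ab | a ≟ b
  ... | false | yes refl = adj-irr G (p a)
  ... | false | no a≢b = perfect-pairing-preserves-nonadjacency wed Q a≢b ab
  ... | true | _ with adj G (p a) (p b) in pab
  ...   | true = refl
  ...   | false with () ← trans (sym ab) (trans (cong₂ (adj G) (sym (partner-involutive a)) (sym (partner-involutive b)))
                          (perfect-pairing-preserves-nonadjacency wed Q (~-≢ ab ∘ partner-injective Q) pab))

  partner-~ : ∀ {a b} → a ~ b → p a ~ p b
  partner-~ {a} {b} a~b = trans (partner-preserves-adj a b) a~b

  -- Replaces the matching edges a(pa), x(px) by ax, (pa)(px); the latter is an edge since p preserves adjacency.
  switch : ∀ {a x} → a ~ x → x ≢ p a → PerfectPairing G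
  switch {a} {x} a~x x≢pa = record
    { partner = s
    ; partner-adj = s-adj
    ; partner-involutive = s-involutive
    }
    where
    r s : V → V
    r = p [ a ⇄ x ]
    s = r [ p a ⇄ p x ]

    a≢pa : a ≢ p a
    a≢pa = partner-≢ Q a ∘ sym
    x≢px : x ≢ p x
    x≢px = partner-≢ Q x ∘ sym
    a≢px : a ≢ p x
    a≢px = x≢pa ∘ partner-flip Q ∘ sym
    s-a : s a ≡ x
    s-a = trans (⇄-other r a≢pa a≢px) (⇄-left p a x)
    s-x : s x ≡ a
    s-x = trans (⇄-other r x≢pa x≢px) (⇄-right p a x)

    s-adj : ∀ v → v ~ s v
    s-adj v with ⇄-cases r (p a) (p x) v
    ... | inj₁ (refl , e) = trans (cong (adj G (p a)) e) (partner-~ a~x)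
    ... | inj₂ (inj₁ (_ , refl , e)) = trans (cong (adj G (p x)) e) (~-sym (partner-~ a~x))
    ... | inj₂ (inj₂ (_ , _ , e)) with ⇄-cases p a x v
    ...   | inj₁ (refl , e′) = trans (cong (adj G a) (trans e e′)) a~x
    ...   | inj₂ (inj₁ (_ , refl , e′)) = trans (cong (adj G x) (trans e e′)) (~-sym a~x)
    ...   | inj₂ (inj₂ (_ , _ , e′)) = trans (cong (adj G v) (trans e e′)) (partner-adj v)

    s-involutive : ∀ v → s (s v) ≡ v
    s-involutive v with ⇄-cases r (p a) (p x) v
    ... | inj₁ (refl , e) = trans (cong s e) (⇄-right r (p a) (p x))
    ... | inj₂ (inj₁ (_ , refl , e)) = trans (cong s e) (⇄-left r (p a) (p x))
    ... | inj₂ (inj₂ (v≢pa , v≢px , e)) with ⇄-cases p a x v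
    ...   | inj₁ (refl , e′) = trans (cong s (trans e e′)) s-x
    ...   | inj₂ (inj₁ (_ , refl , e′)) = trans (cong s (trans e e′)) s-a
    ...   | inj₂ (inj₂ (v≢a , v≢x , e′)) = trans (cong s (trans e e′))
            (trans (⇄-other r (v≢a ∘ partner-injective Q) (v≢x ∘ partner-injective Q))
            (trans (⇄-other p (v≢pa ∘ partner-flip Q) (v≢px ∘ partner-flip Q)) (partner-involutive v)))

  -- Apply the preservation of non-adjacency to the switched pairing, in which pa is matched to px.
  transfer : ∀ {a x w} → a ~ x → x ~ w → x ≢ p a → x ≢ p w → p a ≢ w → p a ~ w
  transfer {a} {x} {w} a~x x~w x≢pa x≢pw pa≢w with a ≟ w
  ... | yes refl = ~-sym (partner-adj a)
  ... | no a≢w with adj G (p a) w in pa~w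
  ...   | true = refl
  ...   | false = ⊥-elim (true≢false (begin
      true               ≡⟨ partner-~ x~w ⟨
      adj G (p x) (p w)  ≡⟨ cong₂ (adj G) s-pa s-w ⟨
      adj G (s (p a)) (s w) ≡⟨ perfect-pairing-preserves-nonadjacency wed (switch a~x x≢pa) pa≢w pa~w ⟩
      false ∎))
    where
    open ≡-Reasoning
    s : V → V
    s = PerfectPairing.partner (switch a~x x≢pa)
    s-pa : s (p a) ≡ p x
    s-pa = ⇄-left (p [ a ⇄ x ]) (p a) (p x)
    s-w : s w ≡ p w
    s-w = trans (⇄-other (p [ a ⇄ x ]) (pa≢w ∘ sym) (x≢pw ∘ partner-flip Q ∘ sym))
                (⇄-other p (a≢w ∘ sym) (~-≢ x~w ∘ sym))

  partner-~⁻¹ : ∀ {a b} → p a ~ p b → a ~ b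
  partner-~⁻¹ {a} {b} e = trans (sym (partner-preserves-adj a b)) e

  SeesMatchedEdge : V → Set
  SeesMatchedEdge z = ∃ λ d → z ~ d × z ~ p d

  sees-matched-edge-partner : ∀ {u z} → SeesMatchedEdge u → u ~ z → z ≢ p u → p u ~ z
  sees-matched-edge-partner {u} {z} (d , u~d , u~pd) u~z z≢pu with z ≟ d | z ≟ p d
  ... | yes refl | _ = subst (λ y → p u ~ y) (partner-involutive d) (partner-~ u~pd)
  ... | no _ | yes refl = partner-~ u~d
  ... | no z≢d | no z≢pd = transfer u~d d~z
          (λ d≡pu → ~-≢ u~pd (sym (trans (cong p d≡pu) (partner-involutive u)))) (z≢pd ∘ partner-flip Q ∘ sym) (z≢pu ∘ sym)
    where
    d~z : d ~ z
    d~z = subst (λ y → y ~ z) (partner-involutive d)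
            (transfer (~-sym u~pd) u~z (λ u≡ppd → ~-≢ u~d (trans u≡ppd (partner-involutive d)))
               (z≢pu ∘ partner-flip Q ∘ sym)
               (λ ppd≡z → z≢d (sym (trans (sym (partner-involutive d)) ppd≡z))))

  sees-matched-edge-step : ∀ {z z'} → SeesMatchedEdge z → z ~ z' → SeesMatchedEdge z'
  sees-matched-edge-step {z} {z'} (d , z~d , z~pd) z~z' with z' ≟ p z
  ... | yes refl = p d , partner-~ z~d , partner-~ z~pd
  ... | no z'≢pz = z , ~-sym z~z' , ~-sym (sees-matched-edge-partner (d , z~d , z~pd) z~z' z'≢pz)

  sees-matched-edge-universal : ∀ {u} → SeesMatchedEdge u → ∀ {w} → Reach G u w → w ≡ u ⊎ u ~ w
  sees-matched-edge-universal {u} full u→w = reach-induction (λ w → w ≡ u ⊎ u ~ w) extend u→w (inj₁ refl)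
    where
    ppu≡u : p (p u) ≡ u
    ppu≡u = partner-involutive u

    extend : ∀ {z z'} → z ≡ u ⊎ u ~ z → z ~ z' → z' ≡ u ⊎ u ~ z'
    extend (inj₁ refl) z~z' = inj₂ z~z'
    extend {z} {z'} (inj₂ u~z) z~z' with z' ≟ u | z ≟ p u
    ... | yes z'≡u | _ = inj₁ z'≡u
    ... | no z'≢u | yes refl = inj₂ (partner-~⁻¹ (sees-matched-edge-partner full
                                 (subst (λ y → y ~ p z') ppu≡u (partner-~ z~z')) (z'≢u ∘ partner-injective Q)))
    ... | no z'≢u | no z≢pu = inj₂ (via-partner (sees-matched-edge-partner full u~z z≢pu) (z' ≟ p z))
      where
      via-partner : p u ~ z → Dec (z' ≡ p z) → u ~ z'
      via-partner pu~z (yes z'≡pz) = subst (u ~_) (sym z'≡pz) (subst (λ y → y ~ p z) ppu≡u (partner-~ pu~z))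
      via-partner pu~z (no z'≢pz) = subst (λ y → y ~ z') ppu≡u
        (transfer pu~z z~z' (λ z≡ppu → ~-≢ u~z (sym (trans z≡ppu ppu≡u))) (z'≢pz ∘ partner-flip Q ∘ sym)
                  (λ ppu≡z' → z'≢u (trans (sym ppu≡z') ppu≡u)))

  sees-matched-edge-complete : (∀ u v → Reach G u v) → ∀ {a} → SeesMatchedEdge a → ∀ u w → u ≢ w → u ~ w
  sees-matched-edge-complete connected {a} full u w u≢w
    with sees-matched-edge-universal (reach-induction SeesMatchedEdge sees-matched-edge-step (connected a u) full) (connected u w)
  ... | inj₁ w≡u = ⊥-elim (u≢w (sym w≡u))
  ... | inj₂ u~w = u~w

  module NoMatchedEdgeSeen (none : ∀ z → ¬ SeesMatchedEdge z) (r : V) where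

    End : V → Set
    End t = t ≡ r ⊎ t ≡ p r

    End-partner : ∀ {t} → End t → End (p t)
    End-partner (inj₁ refl) = inj₂ refl
    End-partner (inj₂ refl) = inj₁ (partner-involutive r)

    SeesEnd : V → Set
    SeesEnd z = ∃ λ t → End t × t ~ z

    sees-end-step : ∀ {z z'} → SeesEnd z → z ~ z' → SeesEnd z'
    sees-end-step {z} {z'} (t , end-t , t~z) z~z' with z ≟ p t | z' ≟ p z | z' ≟ p t
    ... | yes refl | _ | _ = p t , End-partner end-t , z~z'
    ... | no _ | yes refl | _ = p t , End-partner end-t , partner-~ t~z
    ... | no _ | no _ | yes refl = t , end-t , partner-adj t
    ... | no z≢pt | no z'≢pz | no z'≢pt =
      p t , End-partner end-t , transfer t~z z~z' z≢pt (z'≢pz ∘ partner-flip Q ∘ sym) (z'≢pt ∘ sym)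

    side : V → Bool
    side = adj G r

    end : V → V
    end z = if side z then r else p r

    end-adj : (∀ z → SeesEnd z) → ∀ z → end z ~ z
    end-adj sees z with side z in rz | sees z
    ... | true | _ = rz
    ... | false | _ , inj₂ refl , pr~z = pr~z
    ... | false | _ , inj₁ refl , r~z with () ← trans (sym rz) r~z

    module _ (sees : ∀ z → SeesEnd z) where

      private
        end-same : ∀ {a b} → side a ≡ side b → end a ≡ end b
        end-same e = cong (λ s → if s then r else p r) e

        end-other : ∀ {a b} → side a ≢ side b → end b ≡ p (end a)
        end-other {a} {b} ≢ with side a | side b
        ... | true | false = refl
        ... | false | true = sym (partner-involutive r)
        ... | true | true = ⊥-elim (≢ refl)
        ... | false | false = ⊥-elim (≢ refl)

      adjacent-sides-differ : ∀ {a b} → a ~ b → side a ≢ side b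
      adjacent-sides-differ {a} {b} a~b same =
        triangle (end a) (end-adj sees a) (subst (_~ b) (sym (end-same same)) (end-adj sees b))
        where
        triangle : ∀ t → t ~ a → t ~ b → ⊥
        triangle t t~a t~b with b ≟ p t | a ≟ p t | b ≟ p a
        ... | yes b≡pt | _ | _ = none a (t , ~-sym t~a , subst (a ~_) b≡pt a~b)
        ... | no _ | yes a≡pt | _ = none b (t , ~-sym t~b , subst (b ~_) a≡pt (~-sym a~b))
        ... | no _ | no _ | yes b≡pa = none t (a , t~a , subst (t ~_) b≡pa t~b)
        ... | no b≢pt | no a≢pt | no b≢pa =
          none b (a , ~-sym a~b , ~-sym (transfer (~-sym t~a) t~b
                    (a≢pt ∘ partner-flip Q ∘ sym) (b≢pt ∘ partner-flip Q ∘ sym) (b≢pa ∘ sym)))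

      nonadjacent-same-side : ∀ {a b} → a ≢ b → adj G a b ≡ false → side a ≡ side b
      nonadjacent-same-side {a} {b} a≢b a≁b with side a Bool.≟ side b
      ... | yes same = same
      ... | no differ = ⊥-elim (opposite (end a) (end-adj sees a) (subst (_~ b) (end-other differ) (end-adj sees b)))
        where
        opposite : ∀ t → t ~ a → p t ~ b → ⊥
        opposite t t~a pt~b with t ≟ p a | t ≟ b
        ... | yes t≡pa | _ = true≢false (trans (sym (subst (_~ b) (trans (cong p t≡pa) (partner-involutive a)) pt~b)) a≁b)
        ... | no _ | yes refl = true≢false (trans (sym (~-sym t~a)) a≁b)
        ... | no t≢pa | no t≢b = true≢false (trans (sym (subst (_~ b) (partner-involutive a)
              (transfer (partner-~ (~-sym t~a)) pt~b (t≢pa ∘ partner-injective Q) (t≢b ∘ partner-injective Q)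
                        (a≢b ∘ trans (sym (partner-involutive a)))))) a≁b)

      complete-bipartite-formula : ∀ a b → adj G a b ≡ side a xor side b
      complete-bipartite-formula a b with adj G a b in ab | a ≟ b
      ... | true | _ = sym (xor-≢ (adjacent-sides-differ ab))
      ... | false | yes refl = sym (xor-same (side a))
      ... | false | no a≢b = sym (trans (cong (_xor side b) (nonadjacent-same-side a≢b ab)) (xor-same (side b)))

      partner-other-side : ∀ v → side (p v) ≡ not (side v)
      partner-other-side v with side v | side (p v) | trans (sym (partner-adj v)) (complete-bipartite-formula v (p v))
      ... | true | false | _ = refl
      ... | false | true | _ = refl

    sees-end : (∀ u v → Reach G u v) → ∀ z → SeesEnd z
    sees-end connected z = reach-induction SeesEnd sees-end-step (connected r z) (p r , inj₂ refl , ~-sym (partner-adj r))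

  module Star (complete : ∀ u w → u ≢ w → u ~ w) {c z : V} (c≢z : c ≢ z) where

    leaf : V → Bool
    leaf v = not (does (v ≟ c) ∨ does (v ≟ z))

    leaf-intro : ∀ {v} → v ≢ c → v ≢ z → leaf v ≡ true
    leaf-intro {v} v≢c v≢z rewrite dec-false (v ≟ c) v≢c | dec-false (v ≟ z) v≢z = refl

    leaf-elim : ∀ {v} → leaf v ≡ true → v ≢ c × v ≢ z
    leaf-elim {v} lv with v ≟ c | v ≟ z
    ... | no v≢c | no v≢z = v≢c , v≢z

    non-leaf : ∀ {v} → leaf v ≡ false → v ≡ c ⊎ v ≡ z
    non-leaf {v} lv with v ≟ c | v ≟ z
    ... | yes v≡c | _ = inj₁ v≡c
    ... | no _ | yes v≡z = inj₂ v≡z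

    ray : V → V → Bool
    ray i j = does (i ≟ c) ∧ leaf j

    ray-elim : ∀ {i j} → ray i j ≡ true → i ≡ c × leaf j ≡ true
    ray-elim {i} {j} e with i ≟ c | leaf j in lj
    ... | yes i≡c | true = i≡c , refl

    ray-intro : ∀ {l} → leaf l ≡ true → ray c l ≡ true
    ray-intro {l} ll rewrite dec-true (c ≟ c) refl = ll

    star-elim : ∀ {i j} → ray i j ∨ ray j i ≡ true → (i ≡ c × leaf j ≡ true) ⊎ (j ≡ c × leaf i ≡ true)
    star-elim {i} {j} e with ∨-true e
    ... | inj₁ rij = inj₁ (ray-elim {i} {j} rij)
    ... | inj₂ rji = inj₂ (ray-elim {j} {i} rji)

    star : EdgeSet G
    star = record
      { mem = λ i j → ray i j ∨ ray j i
      ; mem-sym = λ i j → ∨-comm (ray i j) (ray j i)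
      ; mem-sub = λ i j e → complete i j (distinct (star-elim {i} {j} e))
      }
      where
      distinct : ∀ {i j} → (i ≡ c × leaf j ≡ true) ⊎ (j ≡ c × leaf i ≡ true) → i ≢ j
      distinct (inj₁ (i≡c , lj)) i≡j = proj₁ (leaf-elim lj) (trans (sym i≡j) i≡c)
      distinct (inj₂ (j≡c , li)) i≡j = proj₁ (leaf-elim li) (trans i≡j j≡c)

    leaf-center : leaf c ≡ false
    leaf-center rewrite dec-true (c ≟ c) refl = refl

    from-center : ∀ l → leaf l ≡ true → mem star c l ≡ true
    from-center l ll = cong (_∨ ray l c) (ray-intro {l} ll)

    to-center : ∀ l → leaf l ≡ true → mem star l c ≡ true
    to-center l ll = trans (mem-sym star l c) (from-center l ll)

    star-dominating : ∀ {y} → y ≢ c → y ≢ z → IsEdgeDominating star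
    star-dominating {y} y≢c y≢z i j i~j _ = cover i j i~j (leaf i) refl (leaf j) refl
      where
      cover : ∀ i j → i ~ j → ∀ bi → leaf i ≡ bi → ∀ bj → leaf j ≡ bj →
              ∃ λ k → (mem star i k ≡ true) ⊎ (mem star j k ≡ true)
      cover i j i~j true li _ _ = c , inj₁ (to-center i li)
      cover i j i~j false _ true lj = c , inj₂ (to-center j lj)
      cover i j i~j false li false lj with non-leaf {i} li | non-leaf {j} lj
      ... | inj₁ refl | inj₁ refl = ⊥-elim (~-≢ i~j refl)
      ... | inj₁ refl | inj₂ refl = y , inj₁ (from-center y (leaf-intro y≢c y≢z))
      ... | inj₂ refl | inj₁ refl = y , inj₂ (from-center y (leaf-intro y≢c y≢z))
      ... | inj₂ refl | inj₂ refl = ⊥-elim (~-≢ i~j refl)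

    -- The ray to a leaf l is the only edge of the star dominating the edge lz.
    star-minimal : IsEdgeDominating star → IsMinimalEdgeDominating star
    star-minimal dom = minimal-by-private-edges star dom private-edge
      where
      nothing-at-z : ∀ {x y} → EdgesAtAre star x y z
      nothing-at-z k e with star-elim {z} {k} e
      ... | inj₁ (z≡c , _) = ⊥-elim (c≢z (sym z≡c))
      ... | inj₂ (_ , lz) = ⊥-elim (proj₂ (leaf-elim lz) refl)

      private-edge : ∀ x y → mem star x y ≡ true →
        ∃ λ a → ∃ λ b → adj G a b ≡ true × EdgesAtAre star x y a × EdgesAtAre star x y b
      private-edge x y e with star-elim {x} {y} e
      ... | inj₁ (refl , ly) = y , z , complete y z (proj₂ (leaf-elim ly)) , at-leaf , nothing-at-z
        where
        at-leaf : EdgesAtAre star c y y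
        at-leaf k e′ with star-elim {y} {k} e′
        ... | inj₁ (y≡c , _) = ⊥-elim (proj₁ (leaf-elim ly) y≡c)
        ... | inj₂ (k≡c , _) = inj₂ (refl , k≡c)
      ... | inj₂ (refl , lx) = x , z , complete x z (proj₂ (leaf-elim lx)) , at-leaf , nothing-at-z
        where
        at-leaf : EdgesAtAre star x c x
        at-leaf k e′ with star-elim {x} {k} e′
        ... | inj₁ (x≡c , _) = ⊥-elim (proj₁ (leaf-elim lx) x≡c)
        ... | inj₂ (k≡c , _) = inj₁ (refl , k≡c)

    leaves : ℕ
    leaves = ∑[ v < vertices G ] ⟦ leaf v ⟧

    leaves-count : leaves + 2 ≡ vertices G
    leaves-count = trans (cong (leaves +_) (sym (sum-pair c≢z))) (sum-complement (λ v → does (v ≟ c) ∨ does (v ≟ z)))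

    degree-center : degree star c ≡ leaves + ⟦ leaf c ⟧
    degree-center = trans (sum-cong-≗ (λ j → cong ⟦_⟧ (at-center j)))
                          (sym (trans (cong (leaves +_) (cong ⟦_⟧ leaf-center)) (+-identityʳ leaves)))
      where
      at-center : ∀ j → ray c j ∨ ray j c ≡ leaf j
      at-center j rewrite dec-true (c ≟ c) refl =
        trans (cong (leaf j ∨_) (∧-zeroʳ (does (j ≟ c)))) (∨-identityʳ (leaf j))

    degree-off-center : ∀ {v} → v ≢ c → degree star v ≡ ⟦ leaf v ⟧
    degree-off-center {v} v≢c = trans (sum-cong-≗ (λ j → cong ⟦_⟧ (off-center j))) (sum-single-∧ c (leaf v))
      where
      off-center : ∀ j → ray v j ∨ ray j v ≡ does (j ≟ c) ∧ leaf v
      off-center j rewrite dec-false (v ≟ c) v≢c = refl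

    star-degree : ∀ v → degree star v ≡ (if does (v ≟ c) then leaves else 0) + ⟦ leaf v ⟧
    star-degree v = by-cases (v ≟ c)
      where
      by-cases : (d : Dec (v ≡ c)) → degree star v ≡ (if does d then leaves else 0) + ⟦ leaf v ⟧
      by-cases (yes v≡c) = subst (λ x → degree star x ≡ leaves + ⟦ leaf x ⟧) (sym v≡c) degree-center
      by-cases (no v≢c) = degree-off-center v≢c

    star-card : card star ≡ leaves
    star-card = double-injective _ _ (begin
      card star + card star                                         ≡⟨ handshake star ⟩
      sum (degree star)                                             ≡⟨ sum-cong-≗ star-degree ⟩
      sum (λ v → (if does (v ≟ c) then leaves else 0) + ⟦ leaf v ⟧)
        ≡⟨ ∑-distrib-+ (λ v → if does (v ≟ c) then leaves else 0) (λ v → ⟦ leaf v ⟧) ⟩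
      sum (λ v → if does (v ≟ c) then leaves else 0) + leaves       ≡⟨ cong (_+ leaves) (sum-at c leaves) ⟩
      leaves + leaves                                               ∎)
      where open ≡-Reasoning

  -- In a complete graph the star at c avoiding z is a minimal edge dominating set with N − 2 edges,
  -- while a perfect matching has N / 2.
  complete-order-four : (∀ u w → u ≢ w → u ~ w) → ∀ {c z y} → c ≢ z → y ≢ c → y ≢ z → vertices G ≡ 4
  complete-order-four complete {c} {z} c≢z y≢c y≢z =
    trans (sym leaves-count) (cong (_+ 2) (+-cancelˡ-≡ leaves leaves 2 (trans twice-leaves (sym leaves-count))))
    where
    open Star complete c≢z
    P : Pairing G
    P = asPairing Q
    twice-leaves : leaves + leaves ≡ vertices G
    twice-leaves = begin
      leaves + leaves                                       ≡⟨ cong₂ _+_ star-card star-card ⟨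
      card star + card star                                 ≡⟨ cong₂ _+_ same-card same-card ⟩
      card (pairingEdges P) + card (pairingEdges P)         ≡⟨ perfect-pairing-card Q ⟩
      vertices G                                            ∎
      where
      open ≡-Reasoning
      same-card : card star ≡ card (pairingEdges P)
      same-card = wed star (pairingEdges P) (star-minimal (star-dominating y≢c y≢z))
        (dominating-matching-minimal (pairingEdges P) (pairingEdges-matching P) (pairingEdges-dominating P (λ _ _ ())))

-- Recognising K n,n and K4

record SideSplit {N : ℕ} (P : Fin N → Bool) : Set where
  field
    left right : ℕ
    bijection : Fin N ↔ (Fin left ⊎ Fin right)
    on-left : ∀ v → isLeft (Inverse.to bijection v) ≡ P v

private
  add-left : ∀ {N} {P : Fin (suc N) → Bool} → P zero ≡ true → SideSplit (P ∘ suc) → SideSplit P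
  add-left {N} {P} P0 s = record
    { left = suc left
    ; right = right
    ; bijection = regroup ↔-∘ (⊎-cong (↔-id _) bijection ↔-∘ +↔⊎ {1} {N})
    ; on-left = λ { zero → sym P0 ; (suc v) → trans (shift (Inverse.to bijection v)) (on-left v) }
    }
    where
    open SideSplit s
    regroup : (Fin 1 ⊎ (Fin left ⊎ Fin right)) ↔ (Fin (suc left) ⊎ Fin right)
    regroup = ⊎-cong (↔-sym +↔⊎) (↔-id _) ↔-∘ ↔-sym (⊎-assoc 0ℓ (Fin 1) (Fin left) (Fin right))
    shift : ∀ x → isLeft (Inverse.to regroup (inj₂ x)) ≡ isLeft x
    shift (inj₁ _) = refl
    shift (inj₂ _) = refl

  flip-sides : ∀ {N} {P : Fin N → Bool} → SideSplit P → SideSplit (not ∘ P)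
  flip-sides s = record
    { left = right
    ; right = left
    ; bijection = ⊎-comm _ _ ↔-∘ bijection
    ; on-left = λ v → trans (swapped (Inverse.to bijection v)) (cong not (on-left v))
    }
    where
    open SideSplit s
    swapped : ∀ x → isLeft (Data.Sum.swap x) ≡ not (isLeft x)
    swapped (inj₁ _) = refl
    swapped (inj₂ _) = refl

  add-right : ∀ {N} {P : Fin (suc N) → Bool} → P zero ≡ false → SideSplit (P ∘ suc) → SideSplit P
  add-right {P = P} P0 s = record
    { left = left ; right = right ; bijection = bijection
    ; on-left = λ v → trans (on-left v) (not-involutive (P v))
    }
    where open SideSplit (flip-sides (add-left {P = not ∘ P} (cong not P0) (flip-sides s)))

sideSplit : ∀ {N} (P : Fin N → Bool) → SideSplit P
sideSplit {zero} P = record { left = 0 ; right = 0 ; bijection = +↔⊎ {0} {0} ; on-left = λ () }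
sideSplit {suc N} P with P zero in P0
... | true = add-left P0 (sideSplit (P ∘ suc))
... | false = add-right P0 (sideSplit (P ∘ suc))

module _ {G : Graph} {side : Fin (vertices G) → Bool} {l r : ℕ} (f : Fin (vertices G) ↔ (Fin l ⊎ Fin r))
         (on-left : ∀ v → isLeft (Inverse.to f v) ≡ side v) where

  private
    N : ℕ
    N = vertices G

  position : Fin N ↔ Fin (l + r)
  position = ↔-sym +↔⊎ ↔-∘ f

  position-side : ∀ v → (toℕ (Inverse.to position v) <ᵇ l) ≡ side v
  position-side v = trans (join-<ᵇ l r (Inverse.to f v)) (on-left v)

  private
    count : (b : Bool → Bool) → ∑[ v < N ] ⟦ b (side v) ⟧ ≡ ∑[ k < l + r ] ⟦ b (toℕ k <ᵇ l) ⟧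
    count b = trans (sum-permute (λ v → ⟦ b (side v) ⟧) (↔-sym position))
      (sum-cong-≗ λ k → cong (⟦_⟧ ∘ b)
        (trans (sym (position-side _)) (cong (λ x → toℕ x <ᵇ l) (Inverse.strictlyInverseˡ position k))))

  left-count : ∑[ v < N ] ⟦ side v ⟧ ≡ l
  left-count = trans (count (λ b → b)) (count-left l r)

  right-count : ∑[ v < N ] ⟦ not (side v) ⟧ ≡ r
  right-count = trans (count not) (count-right l r)

private
  split-≅-Knn : ∀ {G} {side : Fin (vertices G) → Bool} → (∀ i j → adj G i j ≡ side i xor side j) →
                ∀ {l r} (f : Fin (vertices G) ↔ (Fin l ⊎ Fin r)) → (∀ v → isLeft (Inverse.to f v) ≡ side v) →
                r ≡ l → G ≅ Knn l
  split-≅-Knn {G} formula f on-left refl = position {G} f on-left , λ i j →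
    trans (formula i j) (sym (cong₂ _xor_ (position-side {G} f on-left i) (position-side {G} f on-left j)))

balanced-complete-bipartite-≅-Knn : ∀ {G} (side : Fin (vertices G) → Bool) → (∀ i j → adj G i j ≡ side i xor side j) →
  ∑[ v < vertices G ] ⟦ side v ⟧ ≡ ∑[ v < vertices G ] ⟦ not (side v) ⟧ →
  G ≅ Knn (∑[ v < vertices G ] ⟦ side v ⟧)
balanced-complete-bipartite-≅-Knn {G} side formula balanced =
  subst (λ n → G ≅ Knn n) (sym (left-count {G} bijection on-left))
    (split-≅-Knn {G} formula bijection on-left
      (trans (sym (right-count {G} bijection on-left)) (trans (sym balanced) (left-count {G} bijection on-left))))
  where open SideSplit (sideSplit side)

complete-≅-K4 : ∀ {G} → vertices G ≡ 4 → (∀ i j → i ≢ j → adj G i j ≡ true) → G ≅ K4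
complete-≅-K4 {G} e complete = cast-id e , adjacency
  where
  adjacency : ∀ i j → adj G i j ≡ not (toℕ (cast e i) ≡ᵇ toℕ (cast e j))
  adjacency i j rewrite toℕ-cast e i | toℕ-cast e j = trans (by-equality (i ≟ j)) (cong not (does-≟ i j))
    where
    by-equality : (d : Dec (i ≡ j)) → adj G i j ≡ not (does d)
    by-equality (yes refl) = adj-irr G i
    by-equality (no i≢j) = complete i j i≢j

-- The classification

module Classification {G : Graph} (wed : WellEdgeDominated G) (connected : ∀ u v → Reach G u v)
                      (Q : PerfectPairing G) where

  open PerfectlyPaired wed Q
  open PerfectPairing Q renaming (partner to p)

  classify : V → (G ≅ K4) ⊎ (∃ λ n → (1 ≤ n) × (G ≅ Knn n))
  classify r with any? (λ a → any? (λ d → (adj G a d Bool.≟ true) ×-dec (adj G a (p d) Bool.≟ true)))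
  ... | yes (a , d , a~d , a~pd) =
    inj₁ (complete-≅-K4 {G} (complete-order-four complete (~-≢ a~d) (~-≢ a~pd ∘ sym) (partner-≢ Q d)) complete)
    where
    complete : ∀ u w → u ≢ w → u ~ w
    complete = sees-matched-edge-complete connected (d , a~d , a~pd)
  ... | no none = inj₂ (_ , sum-positive side {p r} (partner-adj r) , balanced-complete-bipartite-≅-Knn {G} side formula balanced)
    where
    open NoMatchedEdgeSeen (λ a (d , a~d , a~pd) → none (a , d , a~d , a~pd)) r
    sees : ∀ z → SeesEnd z
    sees = sees-end connected
    formula : ∀ i j → adj G i j ≡ side i xor side j
    formula = complete-bipartite-formula sees
    balanced : ∑[ v < vertices G ] ⟦ side v ⟧ ≡ ∑[ v < vertices G ] ⟦ not (side v) ⟧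
    balanced = trans (sum-permute (λ v → ⟦ side v ⟧) (mk↔ₛ′ p p partner-involutive partner-involutive))
                     (sum-cong-≗ (cong ⟦_⟧ ∘ partner-other-side sees))

theorem7 : (G : Graph) → Connected G → HasPerfectMatching G →
    (WellEdgeDominated G ⇔ ((G ≅ K4) ⊎ (∃ λ (n : ℕ) → (1 ≤ n) × (G ≅ Knn n))))
theorem7 G (nonempty , connected) (M , perfect) = mk⇔ classify characterised
  where
  classify : WellEdgeDominated G → (G ≅ K4) ⊎ (∃ λ n → (1 ≤ n) × (G ≅ Knn n))
  classify wed = Classification.classify wed connected (perfectMatchingPairing M perfect) (fromℕ< nonempty)

  characterised : (G ≅ K4) ⊎ (∃ λ n → (1 ≤ n) × (G ≅ Knn n)) → WellEdgeDominated G
  characterised (inj₁ φ) = well-edge-dominated-≅ K4 φ K4-well-edge-dominated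
  characterised (inj₂ (n , _ , φ)) = well-edge-dominated-≅ (Knn n) φ (Knn-well-edge-dominated n)
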